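{- Let $G$ be a finite simple triangle-free graph and let $H$ be a graph with vertex set $E(G)$. Then $H=L_G$ if and only if there exists a set $F\subseteq E(H)$ such that $H-F=L(G)$ and (i) whenever $H-F$ contains an induced four-cycle with vertices $a,b,c,d$ and edges $ab,bc,cd,ad$, we have $ac,bd\in F$; and (ii) whenever $ac\in F$, there exist vertices $b,d$ with $bd\in F$ such that $a,b,c,d$ induce a four-cycle in $H-F$.
   Context: A biclique of $G$ is a vertex set $B\subseteq V(G)$ such that $G[B]$ is a complete bipartite graph and $B$ is inclusion-wise maximal with this property. The biclique line graph $L_G$ has vertex set $E(G)$, two edges of $G$ being adjacent iff they are both edges of $G[B]$ for some biclique $B$ of $G$. $L(G)$ is the ordinary line graph of $G$ (vertex set $E(G)$, two edges adjacent iff they share an endpoint). $H-F$ denotes the graph obtained from $H$ by deleting the edges in $F$. -}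

module Defs where

open import Data.Nat using (ℕ)
open import Data.Fin using (Fin; _<_)
open import Data.Bool using (Bool; true; false; _∧_; not)
open import Data.Product using (Σ; Σ-syntax; ∃; ∃-syntax; _×_; _,_; proj₁; proj₂)
open import Data.Sum using (_⊎_)
open import Data.Empty using (⊥)
open import Relation.Binary.PropositionalEquality using (_≡_; _≢_)
open import Function.Bundles using (_⇔_)

record SimpleGraph (V : Set) : Set where
  field
    adj    : V → V → Bool
    sym    : ∀ u v → adj u v ≡ adj v u
    irrefl : ∀ u → adj u u ≡ false
open SimpleGraph public

module _ {n : ℕ} (G : SimpleGraph (Fin n)) where

  TriangleFree : Set
  TriangleFree = ∀ u v w → adj G u v ≡ true → adj G v w ≡ true → adj G u w ≡ true → ⊥

  -- E(G): an edge is an unordered pair {u,v}, represented with u < v.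
  Edge : Set
  Edge = Σ (Fin n × Fin n) (λ p → (proj₁ p < proj₂ p) × (adj G (proj₁ p) (proj₂ p) ≡ true))

  src tgt : Edge → Fin n
  src e = proj₁ (proj₁ e)
  tgt e = proj₂ (proj₁ e)

  Incident : Fin n → Edge → Set
  Incident v e = (v ≡ src e) ⊎ (v ≡ tgt e)

  LineAdj : Edge → Edge → Set
  LineAdj e f = (e ≢ f) × (∃[ v ] (Incident v e × Incident v f))

  VSet : Set
  VSet = Fin n → Bool

  _∈_ : Fin n → VSet → Set
  v ∈ B = B v ≡ true

  IsCompleteBipartite : VSet → Set
  IsCompleteBipartite B =
    Σ[ c ∈ (Fin n → Bool) ] ( (∀ u v → u ∈ B → v ∈ B → (adj G u v ≡ true ⇔ c u ≢ c v))
           × (∃[ u ] (u ∈ B × c u ≡ true))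
           × (∃[ v ] (v ∈ B × c v ≡ false)) )

  IsBiclique : VSet → Set
  IsBiclique B = IsCompleteBipartite B
    × (∀ B' → IsCompleteBipartite B' → (∀ v → v ∈ B → v ∈ B') → ∀ v → v ∈ B' → v ∈ B)

  EdgeOf : Edge → VSet → Set
  EdgeOf e B = src e ∈ B × tgt e ∈ B

  BicliqueLineAdj : Edge → Edge → Set
  BicliqueLineAdj e f = (e ≢ f) × (∃[ B ] (IsBiclique B × EdgeOf e B × EdgeOf f B))

_minus_ : {V : Set} → SimpleGraph V → (V → V → Bool) → V → V → Bool
(H minus F) e f = adj H e f ∧ not (F e f)

InducedC4 : {V : Set} → (V → V → Bool) → V → V → V → V → Set
InducedC4 R a b c d =
  (a ≢ b) × (a ≢ c) × (a ≢ d) × (b ≢ c) × (b ≢ d) × (c ≢ d)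
  × (R a b ≡ true) × (R b c ≡ true) × (R c d ≡ true) × (R a d ≡ true)
  × (R a c ≡ false) × (R b d ≡ false)

-- In a triangle-free graph two distinct edges lie in a common biclique iff they share an end or
-- are opposite sides of a 4-cycle: for opposite sides a₁a₂, c₁c₂ with a₁ ~ c₁ and a₂ ~ c₂, the
-- common neighbours X of a₁ and c₂ together with the vertices adjacent to all of X form such a
-- biclique.  Hence L_G is L(G) plus the opposite pairs.  These are exactly the diagonals of the
-- induced 4-cycles of L(G), so (i) and (ii) hold when F is the set of opposite pairs, and
-- conversely (i) and (ii) force F to be that set.
module Submission where

open import Defs
open import Data.Nat using (ℕ)
open import Data.Fin using (Fin)
import Data.Fin.Properties as Fin
open import Data.Bool using (Bool; true; false; not; _∧_)
import Data.Bool.Properties as Bool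
open import Data.Product using (Σ-syntax; ∃-syntax; _×_; _,_; proj₁; proj₂)
open import Data.Sum using (_⊎_; inj₁; inj₂; swap)
open import Data.Sum.Function.Propositional using (_⊎-⇔_)
open import Relation.Nullary using (¬_; Dec; yes; no; does; contradiction)
open import Relation.Nullary.Decidable
  using (dec-true; dec-false; does-⇔; _×-dec_; _⊎-dec_; _→-dec_; ¬?)
open import Relation.Binary.Definitions using (tri<; tri≈; tri>)
open import Relation.Binary.PropositionalEquality as ≡ using (_≡_; _≢_; refl; ≢-sym)
open import Function.Bundles using (_⇔_; mk⇔; Equivalence)
open import Function.Properties.Equivalence using () renaming (trans to ⇔-trans; sym to ⇔-sym)

open Equivalence using (to; from)

does-true⇔ : ∀ {ℓ} {A : Set ℓ} (a? : Dec A) → does a? ≡ true ⇔ A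
does-true⇔ (yes a) = mk⇔ (λ _ → a) (λ _ → refl)
does-true⇔ (no ¬a) = mk⇔ (λ ()) (λ a → contradiction a ¬a)

∧-not-true⇔ : ∀ {x y} → x ∧ not y ≡ true ⇔ (x ≡ true × y ≡ false)
∧-not-true⇔ {true}  {false} = mk⇔ (λ _ → refl , refl) (λ _ → refl)
∧-not-true⇔ {true}  {true}  = mk⇔ (λ ()) (λ { (_ , ()) })
∧-not-true⇔ {false} {_}     = mk⇔ (λ ()) (λ { (() , _) })

true⇔∧-not-true⊎true : ∀ {x y} → (y ≡ true → x ≡ true) → x ≡ true ⇔ (x ∧ not y ≡ true ⊎ y ≡ true)
true⇔∧-not-true⊎true {true}  {true}  _ = mk⇔ (λ _ → inj₂ refl) (λ _ → refl)
true⇔∧-not-true⊎true {true}  {false} _ = mk⇔ (λ _ → inj₁ refl) (λ _ → refl)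
true⇔∧-not-true⊎true {false} {true}  y⇒x with y⇒x refl
... | ()
true⇔∧-not-true⊎true {false} {false} _ = mk⇔ (λ ()) (λ { (inj₁ ()) ; (inj₂ ()) })

true⇔true⇒≡ : ∀ {x y} → x ≡ true ⇔ y ≡ true → x ≡ y
true⇔true⇒≡ {true}  {true}  _   = refl
true⇔true⇒≡ {true}  {false} x⇔y = ≡.sym (to x⇔y refl)
true⇔true⇒≡ {false} {true}  x⇔y = from x⇔y refl
true⇔true⇒≡ {false} {false} _   = refl

≢-matching : ∀ (x y z w : Bool) → x ≢ y → z ≢ w → (x ≢ z × y ≢ w) ⊎ (x ≢ w × y ≢ z)
≢-matching true  true  _ _ x≢y _ = contradiction refl x≢y
≢-matching false false _ _ x≢y _ = contradiction refl x≢y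
≢-matching _ _ true  true  _ z≢w = contradiction refl z≢w
≢-matching _ _ false false _ z≢w = contradiction refl z≢w
≢-matching true  false true  false _ _ = inj₂ ((λ ()) , (λ ()))
≢-matching true  false false true  _ _ = inj₁ ((λ ()) , (λ ()))
≢-matching false true  true  false _ _ = inj₁ ((λ ()) , (λ ()))
≢-matching false true  false true  _ _ = inj₂ ((λ ()) , (λ ()))

InducedC4-rotate : ∀ {V : Set} {R : V → V → Bool} → (∀ e f → R e f ≡ R f e) →
                   ∀ {a b c d} → InducedC4 R a b c d → InducedC4 R b c d a
InducedC4-rotate R-sym {a} {b} {c} {d}
  (a≢b , a≢c , a≢d , b≢c , b≢d , c≢d , ab , bc , cd , ad , ac , bd) =
  b≢c , b≢d , ≢-sym a≢b , c≢d , ≢-sym a≢c , ≢-sym a≢d ,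
  bc , cd , ≡.trans (R-sym d a) ad , ≡.trans (R-sym b a) ab ,
  bd , ≡.trans (R-sym c a) ac

module _ {n : ℕ} (G : SimpleGraph (Fin n)) where

  Adj : Fin n → Fin n → Set
  Adj u v = adj G u v ≡ true

  Adj-sym : ∀ {u v} → Adj u v → Adj v u
  Adj-sym {u} {v} uv = ≡.trans (sym G v u) uv

  Adj⇒≢ : ∀ {u v} → Adj u v → u ≢ v
  Adj⇒≢ {u} uu refl with ≡.trans (≡.sym uu) (irrefl G u)
  ... | ()

  Adj-ends : (e : Edge G) → Adj (src G e) (tgt G e)
  Adj-ends e = proj₂ (proj₂ e)

  incident? : ∀ v e → Dec (Incident G v e)
  incident? v e = (v Fin.≟ src G e) ⊎-dec (v Fin.≟ tgt G e)

  incident-adj : ∀ e {v w} → Incident G v e → Incident G w e → v ≢ w → Adj v w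
  incident-adj e (inj₁ refl) (inj₁ refl) v≢w = contradiction refl v≢w
  incident-adj e (inj₁ refl) (inj₂ refl) _   = Adj-ends e
  incident-adj e (inj₂ refl) (inj₁ refl) _   = Adj-sym (Adj-ends e)
  incident-adj e (inj₂ refl) (inj₂ refl) v≢w = contradiction refl v≢w

  edgeThrough : ∀ {u v} → Adj u v →
    Σ[ e ∈ Edge G ] (Incident G u e × Incident G v e × (∀ {w} → Incident G w e → w ≡ u ⊎ w ≡ v))
  edgeThrough {u} {v} uv with Fin.<-cmp u v
  ... | tri< u<v _ _ = ((u , v) , u<v , uv) , inj₁ refl , inj₂ refl , λ w∈e → w∈e
  ... | tri≈ _ u≡v _ = contradiction u≡v (Adj⇒≢ uv)
  ... | tri> _ _ v<u = ((v , u) , v<u , Adj-sym uv) , inj₂ refl , inj₁ refl , swap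

  ShareEnd : Edge G → Edge G → Set
  ShareEnd e f = ∃[ v ] (Incident G v e × Incident G v f)

  shareEnd? : ∀ e f → Dec (ShareEnd e f)
  shareEnd? e f = Fin.any? (λ v → incident? v e ×-dec incident? v f)

  ShareEnd-sym : ∀ {e f} → ShareEnd e f → ShareEnd f e
  ShareEnd-sym (v , v∈e , v∈f) = v , v∈f , v∈e

  ¬ShareEnd⇒≢ : ∀ {e f} → ¬ ShareEnd e f → e ≢ f
  ¬ShareEnd⇒≢ {e} ¬sh refl = ¬sh (src G e , inj₁ refl , inj₁ refl)

  ¬ShareEnd⇒apart : ∀ {e f v w} → ¬ ShareEnd e f → Incident G v e → Incident G w f → v ≢ w
  ¬ShareEnd⇒apart ¬sh v∈e w∈f refl = ¬sh (_ , v∈e , w∈f)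

  LineAdj-sym : ∀ {e f} → LineAdj G e f → LineAdj G f e
  LineAdj-sym {e} {f} (e≢f , sh) = ≢-sym e≢f , ShareEnd-sym {e} {f} sh

  CrossAdjacent : Edge G → Edge G → Set
  CrossAdjacent e f = (Adj (src G e) (src G f) × Adj (tgt G e) (tgt G f))
                    ⊎ (Adj (src G e) (tgt G f) × Adj (tgt G e) (src G f))

  crossAdjacent? : ∀ e f → Dec (CrossAdjacent e f)
  crossAdjacent? e f =
        (adj G (src G e) (src G f) Bool.≟ true ×-dec adj G (tgt G e) (tgt G f) Bool.≟ true)
    ⊎-dec (adj G (src G e) (tgt G f) Bool.≟ true ×-dec adj G (tgt G e) (src G f) Bool.≟ true)

  CrossAdjacent-sym : ∀ {e f} → CrossAdjacent e f → CrossAdjacent f e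
  CrossAdjacent-sym (inj₁ (ss , tt)) = inj₁ (Adj-sym ss , Adj-sym tt)
  CrossAdjacent-sym (inj₂ (st , ts)) = inj₂ (Adj-sym ts , Adj-sym st)

  crossAdjacent-intro : ∀ e f {p q r s} → Incident G p e → Incident G q e → p ≢ q →
    Incident G r f → Incident G s f → r ≢ s → Adj p r → Adj q s → CrossAdjacent e f
  crossAdjacent-intro e f (inj₁ refl) (inj₁ refl) p≢q _ _ _ _ _ = contradiction refl p≢q
  crossAdjacent-intro e f (inj₂ refl) (inj₂ refl) p≢q _ _ _ _ _ = contradiction refl p≢q
  crossAdjacent-intro e f _ _ _ (inj₁ refl) (inj₁ refl) r≢s _ _ = contradiction refl r≢s
  crossAdjacent-intro e f _ _ _ (inj₂ refl) (inj₂ refl) r≢s _ _ = contradiction refl r≢s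
  crossAdjacent-intro e f (inj₁ refl) (inj₂ refl) _ (inj₁ refl) (inj₂ refl) _ pr qs = inj₁ (pr , qs)
  crossAdjacent-intro e f (inj₁ refl) (inj₂ refl) _ (inj₂ refl) (inj₁ refl) _ pr qs = inj₂ (pr , qs)
  crossAdjacent-intro e f (inj₂ refl) (inj₁ refl) _ (inj₁ refl) (inj₂ refl) _ pr qs = inj₂ (qs , pr)
  crossAdjacent-intro e f (inj₂ refl) (inj₁ refl) _ (inj₂ refl) (inj₁ refl) _ pr qs = inj₁ (qs , pr)

  shareEnd⇒crossAdjacent : ∀ e f → ShareEnd e f → CrossAdjacent e f
  shareEnd⇒crossAdjacent e f (_ , inj₁ refl , inj₁ refl) = inj₂ (Adj-ends f , Adj-sym (Adj-ends e))
  shareEnd⇒crossAdjacent e f (_ , inj₁ refl , inj₂ refl) = inj₁ (Adj-sym (Adj-ends f) , Adj-sym (Adj-ends e))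
  shareEnd⇒crossAdjacent e f (_ , inj₂ refl , inj₁ refl) = inj₁ (Adj-ends e , Adj-ends f)
  shareEnd⇒crossAdjacent e f (_ , inj₂ refl , inj₂ refl) = inj₂ (Adj-ends e , Adj-sym (Adj-ends f))

  Opposite : Edge G → Edge G → Set
  Opposite e f = CrossAdjacent e f × ¬ ShareEnd e f

  opposite? : ∀ e f → Dec (Opposite e f)
  opposite? e f = crossAdjacent? e f ×-dec ¬? (shareEnd? e f)

  Opposite-sym : ∀ {e f} → Opposite e f → Opposite f e
  Opposite-sym {e} {f} (cross , ¬sh) =
    CrossAdjacent-sym {e} {f} cross , λ sh → ¬sh (ShareEnd-sym {f} {e} sh)

  bicliqueLineAdj⇒crossAdjacent : ∀ e f → BicliqueLineAdj G e f → CrossAdjacent e f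
  bicliqueLineAdj⇒crossAdjacent e f (_ , _ , ((c , bip , _) , _) , (e₁ , e₂) , (f₁ , f₂))
    with ≢-matching (c (src G e)) (c (tgt G e)) (c (src G f)) (c (tgt G f))
                    (to (bip _ _ e₁ e₂) (Adj-ends e)) (to (bip _ _ f₁ f₂) (Adj-ends f))
  ... | inj₁ (ss , tt) = inj₁ (from (bip _ _ e₁ f₁) ss , from (bip _ _ e₂ f₂) tt)
  ... | inj₂ (st , ts) = inj₂ (from (bip _ _ e₁ f₂) st , from (bip _ _ e₂ f₁) ts)

  -- For a path p – x – q: X = common neighbours of p and q, Y = vertices adjacent to all of X.
  -- Triangle-freeness makes X and Y independent, so X ∪ Y is a biclique coloured by X.
  module PathBiclique (triangleFree : TriangleFree G) {p x q} (xp : Adj x p) (xq : Adj x q) where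

    InX InY : Fin n → Set
    InX w = Adj w p × Adj w q
    InY w = ∀ z → InX z → Adj w z

    inX? : ∀ w → Dec (InX w)
    inX? w = adj G w p Bool.≟ true ×-dec adj G w q Bool.≟ true

    inY? : ∀ w → Dec (InY w)
    inY? w = Fin.all? (λ z → inX? z →-dec adj G w z Bool.≟ true)

    B : VSet G
    B w = does (inX? w ⊎-dec inY? w)

    ∈B⇔ : ∀ {w} → B w ≡ true ⇔ (InX w ⊎ InY w)
    ∈B⇔ {w} = does-true⇔ (inX? w ⊎-dec inY? w)

    X⊆B : ∀ {w} → InX w → B w ≡ true
    X⊆B w∈X = from ∈B⇔ (inj₁ w∈X)

    Y⊆B : ∀ {w} → InY w → B w ≡ true
    Y⊆B w∈Y = from ∈B⇔ (inj₂ w∈Y)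

    x∈X : InX x
    x∈X = xp , xq

    p∈Y : InY p
    p∈Y z z∈X = Adj-sym (proj₁ z∈X)

    q∈Y : InY q
    q∈Y z z∈X = Adj-sym (proj₂ z∈X)

    adj⇔colours-differ : ∀ {u v} → InX u ⊎ InY u → InX v ⊎ InY v →
      (u? : Dec (InX u)) (v? : Dec (InX v)) → Adj u v ⇔ (does u? ≢ does v?)
    adj⇔colours-differ {u} {v} _ _ (yes u∈X) (yes v∈X) =
      mk⇔ (λ uv → contradiction (proj₁ u∈X) (triangleFree u v p uv (proj₁ v∈X))) (contradiction refl)
    adj⇔colours-differ _ (inj₁ v∈X) _ (no v∉X) = contradiction v∈X v∉X
    adj⇔colours-differ (inj₁ u∈X) _ (no u∉X) _ = contradiction u∈X u∉X
    adj⇔colours-differ _ (inj₂ v∈Y) (yes u∈X) (no _) = mk⇔ (λ _ ()) (λ _ → Adj-sym (v∈Y _ u∈X))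
    adj⇔colours-differ (inj₂ u∈Y) _ (no _) (yes v∈X) = mk⇔ (λ _ ()) (λ _ → u∈Y _ v∈X)
    adj⇔colours-differ {u} {v} (inj₂ u∈Y) (inj₂ v∈Y) (no _) (no _) =
      mk⇔ (λ uv → contradiction (u∈Y x x∈X) (triangleFree u v x uv (v∈Y x x∈X))) (contradiction refl)

    isCompleteBipartite : IsCompleteBipartite G B
    isCompleteBipartite =
        (λ w → does (inX? w))
      , (λ u v u∈B v∈B → adj⇔colours-differ (to ∈B⇔ u∈B) (to ∈B⇔ v∈B)
                                             (inX? u) (inX? v))
      , (x , X⊆B x∈X , dec-true (inX? x) x∈X)
      , (p , Y⊆B p∈Y , dec-false (inX? p) (λ p∈X → Adj⇒≢ (proj₁ p∈X) refl))

    -- In a larger complete bipartite B', p and q get the colour opposite to x; a vertex of that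
    -- colour is adjacent to all of X (whose colour is x's), any other to p and q.
    maximal : ∀ B' → IsCompleteBipartite G B' → (∀ v → B v ≡ true → B' v ≡ true) →
              ∀ w → B' w ≡ true → B w ≡ true
    maximal B' (c , bip , _) B⊆B' w w∈B' = place (c w Bool.≟ c p)
      where
        X⊆B' : ∀ {z} → InX z → B' z ≡ true
        X⊆B' z∈X = B⊆B' _ (X⊆B z∈X)
        p∈B' : B' p ≡ true
        p∈B' = B⊆B' p (Y⊆B p∈Y)
        q∈B' : B' q ≡ true
        q∈B' = B⊆B' q (Y⊆B q∈Y)
        cq≡cp : c q ≡ c p
        cq≡cp = ≡.trans (Bool.¬-not (to (bip q x q∈B' (X⊆B' x∈X)) (Adj-sym xq)))
                        (≡.sym (Bool.¬-not (to (bip p x p∈B' (X⊆B' x∈X)) (Adj-sym xp))))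
        place : Dec (c w ≡ c p) → B w ≡ true
        place (yes cw≡cp) = Y⊆B λ z z∈X →
          from (bip w z w∈B' (X⊆B' z∈X)) λ cw≡cz →
            to (bip z p (X⊆B' z∈X) p∈B') (proj₁ z∈X) (≡.trans (≡.sym cw≡cz) cw≡cp)
        place (no cw≢cp) =
          X⊆B (from (bip w p w∈B' p∈B') cw≢cp
             , from (bip w q w∈B' q∈B') (λ cw≡cq → cw≢cp (≡.trans cw≡cq cq≡cp)))

    isBiclique : IsBiclique G B
    isBiclique = isCompleteBipartite , maximal

  crossAdjacent⇒bicliqueLineAdj : TriangleFree G → ∀ {e f} → e ≢ f → CrossAdjacent e f →
                                   BicliqueLineAdj G e f
  crossAdjacent⇒bicliqueLineAdj triangleFree {e} {f} e≢f (inj₁ (ss , tt)) =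
    e≢f , B , isBiclique , (Y⊆B p∈Y , X⊆B x∈X) , (X⊆B (Adj-sym ss , Adj-ends f) , Y⊆B q∈Y)
    where open PathBiclique triangleFree (Adj-sym (Adj-ends e)) tt
  crossAdjacent⇒bicliqueLineAdj triangleFree {e} {f} e≢f (inj₂ (st , ts)) =
    e≢f , B , isBiclique , (Y⊆B p∈Y , X⊆B x∈X) , (Y⊆B q∈Y , X⊆B (Adj-sym st , Adj-sym (Adj-ends f)))
    where open PathBiclique triangleFree (Adj-sym (Adj-ends e)) ts

  bicliqueLineAdj⇔ : TriangleFree G → ∀ e f →
                     BicliqueLineAdj G e f ⇔ (LineAdj G e f ⊎ Opposite e f)
  bicliqueLineAdj⇔ triangleFree e f = mk⇔ (λ bla → split bla (shareEnd? e f)) join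
    where
      split : BicliqueLineAdj G e f → Dec (ShareEnd e f) → LineAdj G e f ⊎ Opposite e f
      split (e≢f , _) (yes sh) = inj₁ (e≢f , sh)
      split bla       (no ¬sh) = inj₂ (bicliqueLineAdj⇒crossAdjacent e f bla , ¬sh)
      join : LineAdj G e f ⊎ Opposite e f → BicliqueLineAdj G e f
      join (inj₁ (e≢f , sh)) =
        crossAdjacent⇒bicliqueLineAdj triangleFree e≢f (shareEnd⇒crossAdjacent e f sh)
      join (inj₂ (cross , ¬sh)) = crossAdjacent⇒bicliqueLineAdj triangleFree (¬ShareEnd⇒≢ ¬sh) cross

  IsLineGraph : (Edge G → Edge G → Bool) → Set
  IsLineGraph R = ∀ e f → R e f ≡ true ⇔ LineAdj G e f

  module LineGraph {R : Edge G → Edge G → Bool} (R⇔ : IsLineGraph R) where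

    R-sym : ∀ e f → R e f ≡ R f e
    R-sym e f = true⇔true⇒≡ (mk⇔ (λ ef → from (R⇔ f e) (LineAdj-sym (to (R⇔ e f) ef)))
                                 (λ fe → from (R⇔ e f) (LineAdj-sym (to (R⇔ f e) fe))))

    adjacent⇒shareEnd : ∀ {e f} → R e f ≡ true → ShareEnd e f
    adjacent⇒shareEnd {e} {f} ef = proj₂ (to (R⇔ e f) ef)

    shareEnd⇒adjacent : ∀ {e f v} → e ≢ f → Incident G v e → Incident G v f → R e f ≡ true
    shareEnd⇒adjacent {e} {f} e≢f v∈e v∈f = from (R⇔ e f) (e≢f , _ , v∈e , v∈f)

    nonadjacent⇒¬shareEnd : ∀ {e f} → e ≢ f → R e f ≡ false → ¬ ShareEnd e f
    nonadjacent⇒¬shareEnd {e} {f} e≢f ef sh with ≡.trans (≡.sym (from (R⇔ e f) (e≢f , sh))) ef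
    ... | ()

    ¬shareEnd⇒nonadjacent : ∀ {e f} → ¬ ShareEnd e f → R e f ≡ false
    ¬shareEnd⇒nonadjacent ¬sh = Bool.¬-not (λ ef → ¬sh (adjacent⇒shareEnd ef))

    -- With v₁ ∈ a ∩ b, v₂ ∈ b ∩ c, v₃ ∈ c ∩ d, v₄ ∈ d ∩ a, the cycle v₁ v₂ v₃ v₄ of G is a 4-cycle
    -- because a, c and b, d share no end.
    inducedC4⇒opposite : ∀ {a b c d} → InducedC4 R a b c d → Opposite a c
    inducedC4⇒opposite {a} {b} {c} {d} (_ , a≢c , _ , _ , b≢d , _ , ab , bc , cd , ad , ac , bd)
      with adjacent⇒shareEnd ab | adjacent⇒shareEnd bc | adjacent⇒shareEnd cd | adjacent⇒shareEnd ad
    ... | v₁ , v₁∈a , v₁∈b | v₂ , v₂∈b , v₂∈c | v₃ , v₃∈c , v₃∈d | v₄ , v₄∈a , v₄∈d =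
        crossAdjacent-intro a c v₁∈a v₄∈a (¬ShareEnd⇒apart {b} {d} ¬bd v₁∈b v₄∈d)
                                v₂∈c v₃∈c (¬ShareEnd⇒apart {b} {d} ¬bd v₂∈b v₃∈d)
          (incident-adj b v₁∈b v₂∈b (¬ShareEnd⇒apart {a} {c} ¬ac v₁∈a v₂∈c))
          (incident-adj d v₄∈d v₃∈d (¬ShareEnd⇒apart {a} {c} ¬ac v₄∈a v₃∈c))
      , ¬ac
      where
        ¬ac : ¬ ShareEnd a c
        ¬ac = nonadjacent⇒¬shareEnd a≢c ac
        ¬bd : ¬ ShareEnd b d
        ¬bd = nonadjacent⇒¬shareEnd b≢d bd

    inducedC4⇒opposite-diagonals : ∀ {a b c d} → InducedC4 R a b c d → Opposite a c × Opposite b d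
    inducedC4⇒opposite-diagonals c4 = inducedC4⇒opposite c4 , inducedC4⇒opposite (InducedC4-rotate R-sym c4)

    -- The 4-cycle p q r s of G, with a = pq and c = rs, gives the induced 4-cycle a, qr, c, sp.
    4-cycle⇒inducedC4 : ∀ {a c p q r s} → ¬ ShareEnd a c →
      Incident G p a → Incident G q a → p ≢ q → Incident G r c → Incident G s c → r ≢ s →
      Adj q r → Adj s p → ∃[ b ] ∃[ d ] (Opposite b d × InducedC4 R a b c d)
    4-cycle⇒inducedC4 {a} {c} {p} {q} {r} {s} ¬ac p∈a q∈a p≢q r∈c s∈c r≢s qr sp
      with edgeThrough qr | edgeThrough sp
    ... | b , q∈b , r∈b , ends-b | d , s∈d , p∈d , ends-d =
        b , d , (cross-bd , ¬bd)
      , (a≢b , ¬ShareEnd⇒≢ ¬ac , a≢d , b≢c , ¬ShareEnd⇒≢ ¬bd , c≢d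
      , shareEnd⇒adjacent a≢b q∈a q∈b , shareEnd⇒adjacent b≢c r∈b r∈c
      , shareEnd⇒adjacent c≢d s∈c s∈d , shareEnd⇒adjacent a≢d p∈a p∈d
      , ¬shareEnd⇒nonadjacent ¬ac , ¬shareEnd⇒nonadjacent ¬bd)
      where
        apart : ∀ {v w} → Incident G v a → Incident G w c → v ≢ w
        apart = ¬ShareEnd⇒apart {a} {c} ¬ac
        a≢b : a ≢ b
        a≢b refl = apart r∈b r∈c refl
        a≢d : a ≢ d
        a≢d refl = apart s∈d s∈c refl
        b≢c : b ≢ c
        b≢c refl = apart q∈a q∈b refl
        c≢d : c ≢ d
        c≢d refl = apart p∈a p∈d refl
        ¬bd : ¬ ShareEnd b d
        ¬bd (w , w∈b , w∈d) with ends-b w∈b | ends-d w∈d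
        ... | inj₁ w≡q | inj₁ w≡s = apart q∈a s∈c (≡.trans (≡.sym w≡q) w≡s)
        ... | inj₁ w≡q | inj₂ w≡p = p≢q (≡.trans (≡.sym w≡p) w≡q)
        ... | inj₂ w≡r | inj₁ w≡s = r≢s (≡.trans (≡.sym w≡r) w≡s)
        ... | inj₂ w≡r | inj₂ w≡p = apart p∈a r∈c (≡.trans (≡.sym w≡p) w≡r)
        cross-bd : CrossAdjacent b d
        cross-bd = crossAdjacent-intro b d q∈b r∈b (apart q∈a r∈c) p∈d s∈d (apart p∈a s∈c)
                     (incident-adj a q∈a p∈a (≢-sym p≢q)) (incident-adj c r∈c s∈c r≢s)

    opposite⇒inducedC4 : ∀ {a c} → Opposite a c → ∃[ b ] ∃[ d ] (Opposite b d × InducedC4 R a b c d)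
    opposite⇒inducedC4 {a} {c} (inj₁ (ss , tt) , ¬ac) =
      4-cycle⇒inducedC4 ¬ac (inj₁ refl) (inj₂ refl) (Adj⇒≢ (Adj-ends a))
                            (inj₂ refl) (inj₁ refl) (≢-sym (Adj⇒≢ (Adj-ends c))) tt (Adj-sym ss)
    opposite⇒inducedC4 {a} {c} (inj₂ (st , ts) , ¬ac) =
      4-cycle⇒inducedC4 ¬ac (inj₁ refl) (inj₂ refl) (Adj⇒≢ (Adj-ends a))
                            (inj₁ refl) (inj₂ refl) (Adj⇒≢ (Adj-ends c)) ts (Adj-sym st)

  oppositeᵇ : Edge G → Edge G → Bool
  oppositeᵇ e f = does (opposite? e f)

  oppositeᵇ⇔ : ∀ e f → oppositeᵇ e f ≡ true ⇔ Opposite e f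
  oppositeᵇ⇔ e f = does-true⇔ (opposite? e f)

  module _ (H : SimpleGraph (Edge G)) where

    IsBicliqueLineGraph : Set
    IsBicliqueLineGraph = ∀ e f → adj H e f ≡ true ⇔ BicliqueLineAdj G e f

    LineGraphSplitting : (Edge G → Edge G → Bool) → Set
    LineGraphSplitting F =
        (∀ e f → F e f ≡ F f e)
      × (∀ e f → F e f ≡ true → adj H e f ≡ true)
      × IsLineGraph (H minus F)
      × (∀ a b c d → InducedC4 (H minus F) a b c d → (F a c ≡ true × F b d ≡ true))
      × (∀ a c → F a c ≡ true → ∃[ b ] ∃[ d ] (F b d ≡ true × InducedC4 (H minus F) a b c d))

    splitting⇒F⇔opposite : ∀ {F} → LineGraphSplitting F → ∀ e f → F e f ≡ true ⇔ Opposite e f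
    splitting⇒F⇔opposite (_ , _ , minus⇔ , inducedC4⇒F , F⇒inducedC4) e f =
      mk⇔ (λ Fef → let (_ , _ , _ , c4) = F⇒inducedC4 e f Fef in inducedC4⇒opposite c4)
          (λ opp → let (b , d , _ , c4) = opposite⇒inducedC4 opp in proj₁ (inducedC4⇒F e b f d c4))
      where open LineGraph minus⇔

    module _ (triangleFree : TriangleFree G) where

      bicliqueLineGraph⇒splitting : IsBicliqueLineGraph → LineGraphSplitting oppositeᵇ
      bicliqueLineGraph⇒splitting H⇔ =
        (λ e f → does-⇔ (mk⇔ (Opposite-sym {e} {f}) (Opposite-sym {f} {e}))
                         (opposite? e f) (opposite? f e))
        , (λ e f opp → from (H⇔′ e f) (inj₂ (to (oppositeᵇ⇔ e f) opp)))
        , minus⇔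
        , (λ a b c d c4 → let (ac , bd) = inducedC4⇒opposite-diagonals c4
                          in from (oppositeᵇ⇔ a c) ac , from (oppositeᵇ⇔ b d) bd)
        , (λ a c opp → let (b , d , bd , c4) = opposite⇒inducedC4 (to (oppositeᵇ⇔ a c) opp)
                       in b , d , from (oppositeᵇ⇔ b d) bd , c4)
        where
          H⇔′ : ∀ e f → adj H e f ≡ true ⇔ (LineAdj G e f ⊎ Opposite e f)
          H⇔′ e f = ⇔-trans (H⇔ e f) (bicliqueLineAdj⇔ triangleFree e f)
          -- An opposite pair shares no end, so L(G) and the opposite pairs are disjoint.
          minus⇔ : IsLineGraph (H minus oppositeᵇ)
          minus⇔ e f = mk⇔
            (λ m → let (Hef , ¬opp) = to ∧-not-true⇔ m in case-line (to (H⇔′ e f) Hef) ¬opp)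
            (λ la → from ∧-not-true⇔
               (from (H⇔′ e f) (inj₁ la) , dec-false (opposite? e f) (λ opp → proj₂ opp (proj₂ la))))
            where
              case-line : LineAdj G e f ⊎ Opposite e f → oppositeᵇ e f ≡ false → LineAdj G e f
              case-line (inj₁ la)  _    = la
              case-line (inj₂ opp) ¬opp = contradiction (from (oppositeᵇ⇔ e f) opp) (Bool.not-¬ ¬opp)
          open LineGraph minus⇔

      splitting⇒bicliqueLineGraph : ∀ {F} → LineGraphSplitting F → IsBicliqueLineGraph
      splitting⇒bicliqueLineGraph split@(_ , F⊆H , minus⇔ , _) e f =
        ⇔-trans (true⇔∧-not-true⊎true (F⊆H e f))
          (⇔-trans (minus⇔ e f ⊎-⇔ splitting⇒F⇔opposite split e f)
                   (⇔-sym (bicliqueLineAdj⇔ triangleFree e f)))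

theorem15 : ∀ {n : ℕ} (G : SimpleGraph (Fin n)) → TriangleFree G → (H : SimpleGraph (Edge G)) →
    ( (∀ e f → (adj H e f ≡ true ⇔ BicliqueLineAdj G e f))
      ⇔ (Σ[ F ∈ (Edge G → Edge G → Bool) ] ( (∀ e f → F e f ≡ F f e)
                × (∀ e f → F e f ≡ true → adj H e f ≡ true)
                × (∀ e f → ((H minus F) e f ≡ true ⇔ LineAdj G e f))
                × (∀ a b c d → InducedC4 (H minus F) a b c d → (F a c ≡ true × F b d ≡ true))
                × (∀ a c → F a c ≡ true →
                     ∃[ b ] ∃[ d ] (F b d ≡ true × InducedC4 (H minus F) a b c d)) )) )
theorem15 G triangleFree H =
  mk⇔ (λ H⇔ → oppositeᵇ G , bicliqueLineGraph⇒splitting G H triangleFree H⇔)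
      (λ (_ , split) → splitting⇒bicliqueLineGraph G H triangleFree split)
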